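{- Let $g\notin\{ -1,0,1\}$ be rational, written as $g=\pm g_0^h$ with $g_0>0$ rational not an exact power of a rational and $h\ge1$ an integer, and let $n\ge1$. Let $a$ and $f$ be coprime natural numbers with $a\equiv1\pmod{(f,n)}$. Then the Kronecker symbol $\left(\frac{\gamma_g(f,n)}{a}\right)$ is nonzero. If moreover $D(g_0)_{\rm odd}\nmid[f,n]$, then $\left(\frac{\gamma_g(f,n)}{a}\right)=1$.
   Context: For a nonzero rational $g_1$, $D(g_1)$ is the discriminant of $\mathbb{Q}(\sqrt{g_1})$; a fundamental discriminant is an integer of this form. For an integer $m$, $m_{\rm odd}$ is its largest odd divisor. For a fundamental discriminant $D$ (with $f,n$ fixed), let $b=D/(f,D)$ and $\gamma(D)=(-1)^{((f_{\rm odd},D)-1)/2}(f_{\rm odd},D)$ if $\nu_2(f)<\nu_2(D)$, $\gamma(D)=(-1)^{(b-1)/2}(f,D)$ otherwise; $\gamma_0(D)=\gamma(D)$ if $D\nmid n$ and $D\mid[f,n]$, else $1$; $\gamma_1(D)=\gamma(D)$ if $\nu_2(f)>\nu_2(n)$ and $D\mid[f,n]$, else $1$. Cases (exactly one applies): (1) $g>0$, $\nu_2(n)\le\nu_2(h)$; (2) $g>0$, $\nu_2(n)\ge\nu_2(h)+1$; (3) $g<0$, $\nu_2(n)\ge\nu_2(h)+2$; (4) $g<0$, $\nu_2(n)=1$, $\nu_2(h)=0$; (5) $g<0$, $\nu_2(h)=1$, $\nu_2(n)=2$, $8\mid D(g_0)$; (6) $g<0$, $\nu_2(n)\le\nu_2(h)$;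 (7) $g<0$, $\nu_2(n)=\nu_2(h)+1$ and none of (1)–(6). Then $\gamma_g(f,n)$ is $1$ in cases (1),(6); $\gamma_0(D(g_0))$ in cases (2),(3); $\gamma_0(D(-g_0))$ in case (4); $\gamma_0(D(2g_0))$ in case (5); $\gamma_1(D(g_0))$ in case (7). $\left(\frac{\cdot}{\cdot}\right)$ is the Kronecker symbol. -}

module Defs where

open import Data.Bool.Base using (Bool; true; false; if_then_else_; _∧_; not)
open import Data.Nat.Base as ℕ using (ℕ; zero; suc; _≡ᵇ_; _≤ᵇ_; _<ᵇ_)
open import Data.Nat.DivMod using (_/_; _%_)
open import Data.Nat.Divisibility using (_∣?_)
open import Data.Nat.GCD using (gcd)
open import Data.Nat.LCM using (lcm)
open import Data.Nat.Primality using (prime?)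
open import Data.Integer.Base as ℤ using (ℤ; +_; ∣_∣; _◃_; sign; _/ℕ_; _%ℕ_)
open import Data.Rational.Base as ℚ using (ℚ; 0ℚ; 1ℚ)
open import Data.Rational.Properties using (_<?_)
open import Data.List.Base using (List; upTo; foldr; map)
open import Data.Bool.ListAction using (any)
open import Relation.Nullary.Decidable using (⌊_⌋)
open import Data.Product using (Σ; _×_)
open import Relation.Binary.PropositionalEquality using (_≡_)

_^ℚ_ : ℚ → ℕ → ℚ
r ^ℚ zero  = 1ℚ
r ^ℚ suc k = r ℚ.* (r ^ℚ k)

IsPerfectPower : ℚ → Set
IsPerfectPower r = Σ ℚ λ s → Σ ℕ λ k → (2 ℕ.≤ k) × (r ≡ s ^ℚ k)

-- p-adic valuation of a natural number (for p ≥ 2; p = 2 + k),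
-- ν(0) is set to 0 (never used on 0 in the statement)

νgo : (k fuel m : ℕ) → ℕ
νgo k zero m = 0
νgo k (suc fuel) m =
  if (not (m ≡ᵇ 0)) ∧ (m % (2 ℕ.+ k) ≡ᵇ 0)
  then suc (νgo k fuel (m / (2 ℕ.+ k)))
  else 0

ν[2+_] : ℕ → ℕ → ℕ
ν[2+ k ] m = νgo k m m

ν₂ : ℕ → ℕ
ν₂ = ν[2+ 0 ]

oddGo : (fuel m : ℕ) → ℕ
oddGo zero m = m
oddGo (suc fuel) m =
  if (not (m ≡ᵇ 0)) ∧ (m % 2 ≡ᵇ 0) then oddGo fuel (m / 2) else m

oddPart : ℕ → ℕ
oddPart m = oddGo m m

-- sqSearch m k : the largest d ≤ k with d² ∣ m, returned as d - 1
-- (and 0, i.e. d = 1, if there is none)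
sqSearch : ℕ → ℕ → ℕ
sqSearch m zero = 0
sqSearch m (suc k) = if ⌊ (suc k ℕ.* suc k) ∣? m ⌋ then k else sqSearch m k

sqfree : ℕ → ℕ
sqfree m = m / (suc (sqSearch m m) ℕ.* suc (sqSearch m m))

-- D(g₁): the discriminant of Q(√g₁) for a nonzero rational g₁.
-- With g₁ = p/q in lowest terms, d = squarefree part of p·q (with sign);
-- D = d if d ≡ 1 (mod 4), and D = 4d otherwise.
disc : ℚ → ℤ
disc g₁ =
  let m = ℚ.numerator g₁ ℤ.* ℚ.denominator g₁
      d = sign m ◃ sqfree ∣ m ∣
  in if d %ℕ 4 ≡ᵇ 1 then d else + 4 ℤ.* d

kron2 : ℤ → ℤ
kron2 D = if D %ℕ 2 ≡ᵇ 0 then + 0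
          else (if (D %ℕ 8 ≡ᵇ 1) Data.Bool.Base.∨ (D %ℕ 8 ≡ᵇ 7) then + 1 else ℤ.- + 1)

legendre : ℤ → ℕ → ℤ
legendre D k =
  let p = 2 ℕ.+ k
      r = D %ℕ p
  in if r ≡ᵇ 0 then + 0
     else (if any (λ x → (x ℕ.* x) % p ≡ᵇ r) (upTo p) then + 1 else ℤ.- + 1)

kronPrime : ℤ → ℕ → ℤ
kronPrime D zero    = kron2 D
kronPrime D (suc k) = legendre D (suc k)

kronecker : ℤ → ℕ → ℤ
kronecker D zero = if ∣ D ∣ ≡ᵇ 1 then + 1 else + 0
kronecker D a@(suc _) =
  foldr ℤ._*_ (+ 1)
    (map (λ k → if ⌊ prime? (2 ℕ.+ k) ⌋ then kronPrime D k ℤ.^ ν[2+ k ] a else + 1)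
         (upTo a))

-- (-1)^((b-1)/2) for odd b
εsign : ℤ → ℤ
εsign b = if b %ℕ 4 ≡ᵇ 1 then + 1 else ℤ.- + 1

-- exact division D / c (c ≠ 0 in all uses)
divExact : ℤ → ℕ → ℤ
divExact D zero    = + 0
divExact D (suc c) = D /ℕ suc c

module _ (f n : ℕ) where

  γ : ℤ → ℤ
  γ D =
    let c  = gcd f ∣ D ∣
        b  = divExact D c
        co = gcd (oddPart f) ∣ D ∣
    in if ν₂ f <ᵇ ν₂ ∣ D ∣
       then εsign (+ co) ℤ.* + co
       else εsign b ℤ.* + c

  γ₀ : ℤ → ℤ
  γ₀ D = if not ⌊ ∣ D ∣ ∣? n ⌋ ∧ ⌊ ∣ D ∣ ∣? lcm f n ⌋ then γ D else + 1

  γ₁ : ℤ → ℤ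
  γ₁ D = if (ν₂ n <ᵇ ν₂ f) ∧ ⌊ ∣ D ∣ ∣? lcm f n ⌋ then γ D else + 1

-- γ_g(f,n) where g = ± g₀^h (the sign being that of g)
γg : (g g₀ : ℚ) (h f n : ℕ) → ℤ
γg g g₀ h f n =
  let vn = ν₂ n
      vh = ν₂ h
      Dg₀ = disc g₀
  in if ⌊ 0ℚ <? g ⌋
     then (if vn ≤ᵇ vh then + 1
           else γ₀ f n Dg₀)
     else (if (2 ℕ.+ vh) ≤ᵇ vn then γ₀ f n Dg₀
           else if (vn ≡ᵇ 1) ∧ (vh ≡ᵇ 0)
                then γ₀ f n (disc (ℚ.- g₀))
           else if (vh ≡ᵇ 1) ∧ (vn ≡ᵇ 2) ∧ ⌊ 8 ∣? ∣ Dg₀ ∣ ⌋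
                then γ₀ f n (disc ((+ 2 ℚ./ 1) ℚ.* g₀))
           else if vn ≤ᵇ vh then + 1
           else γ₁ f n Dg₀)

private
  open import Relation.Binary.PropositionalEquality using (refl)
  t1 : kronecker (ℤ.- + 3) 7 ≡ + 1
  t1 = refl
  t2 : kronecker (+ 5) 6 ≡ + 1
  t2 = refl
  t3 : kronecker (+ 5) 3 ≡ ℤ.- + 1
  t3 = refl
  t4 : disc (+ 12 ℚ./ 1) ≡ + 12
  t4 = refl
  t5 : disc (ℚ.- (+ 3 ℚ./ 4)) ≡ ℤ.- + 3
  t5 = refl
  t6 : disc (+ 2 ℚ./ 3) ≡ + 24
  t6 = refl
  t7 : oddPart 24 ≡ 3
  t7 = refl

{-# OPTIONS --safe #-}
-- |γ_g(f,n)| always divides f, being 1, |(f,D)| or |(f_odd,D)|; so it is coprime to a, no prime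
-- p ∣ a has (γ_g(f,n)/p) = 0, and the Kronecker symbol is a product of units.
-- In every case γ_g(f,n) is 1 or γ(D) guarded by D ∣ [f,n], for some D ∈ {D(g₀), D(−g₀), D(2g₀)}.
-- The square-free kernels of g₀, −g₀ and 2g₀ differ by at most a factor 2, so D(g₀)_odd divides
-- each such |D|; if it does not divide [f,n], every guard fails and γ_g(f,n) = 1.
module Submission where

open import Defs
open import Data.Bool.Base using (Bool; true; false; T; if_then_else_; _∧_; not)
open import Data.Bool.Properties using (if-float; if-eta; if-cong; if-cong-then; ∧-zeroʳ)
open import Data.Nat.Base as ℕ
  using (ℕ; zero; suc; _+_; _*_; _≤_; _∸_; z≤n; s≤s; s≤s⁻¹; NonZero; ≢-nonZero⁻¹; _≡ᵇ_; _<ᵇ_; _≤ᵇ_)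
open import Data.Nat.Properties
  using (≡ᵇ⇒≡; ≡⇒≡ᵇ; ≤-refl; ≤-antisym; ≤-trans; m≤n⇒m<n∨m≡n; m≤m*n; m≤n*m; m<m*n; *-monoʳ-≤; m*n≢0;
         *-comm; *-assoc; *-identityˡ; *-identityʳ; *-cancelʳ-≡)
open import Data.Nat.DivMod using (_/_; _%_; m/n*n≡m; m/n<m; m≥n⇒m/n>0)
open import Data.Nat.Divisibility
  using (_∣_; _∤_; divides; _∣?_; ∣-refl; ∣-trans; ∣-reflexive; 1∣_; _∣0; 0∣⇒≡0; ∣⇒≤; m%n≡0⇒n∣m; n∣m⇒m%n≡0;
         m/n∣m; ∣m⇒∣m*n; ∣n⇒∣m*n; *-cancelˡ-∣)
open import Data.Nat.Coprimality using (Coprime; 0-coprimeTo-m⇒m≡1; coprime-divisor; coprime-factors; recompute)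
open import Data.Nat.GCD using (gcd; gcd[m,n]∣m; gcd[m,n]∣n)
open import Data.Nat.LCM using (lcm)
open import Data.Sign.Base using (Sign)
open import Data.Integer.Base as ℤ using (ℤ; +_; -[1+_]; ∣_∣)
open import Data.Integer.DivMod using (a≡a%ℕn+[a/ℕn]*n)
open import Data.Integer.Properties as ℤ using (abs-*; abs-◃; i*j≡0⇒i≡0∨j≡0; ^-zeroˡ; ∣-i∣≡∣i∣; neg-distribˡ-*)
open import Data.Rational.Base as ℚ using (ℚ; mkℚ; ↥_; ↧_; ↧ₙ_; 0ℚ; 1ℚ; -_; _<_; *<*)
open import Data.Rational.Properties using (_<?_; ↥-neg; ↧-neg; ↥-/; ↧-/)
open import Data.Nat.Primality using (euclidsLemma; prime[2]; prime?)
open import Data.List.Base using ([]; _∷_; foldr; map; upTo)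
open import Data.Nat.Induction using (<-wellFounded)
open import Data.Nat.Tactic.RingSolver using (solve-∀)
open import Induction.WellFounded using (Acc; acc)
open import Data.Product using (_×_; _,_)
open import Data.Sum as Sum using (_⊎_; inj₁; inj₂; [_,_]′; swap)
open import Function.Base using (_∘′_)
open import Relation.Nullary using (¬_; yes; no; contradiction)
open import Relation.Nullary.Decidable using (⌊_⌋)
open import Relation.Binary.PropositionalEquality
  using (_≡_; _≢_; refl; sym; trans; cong; cong₂; subst; subst₂; module ≡-Reasoning)

private
  variable
    k m t x y : ℕ

if-intro : ∀ {a p} {A : Set a} (P : A → Set p) b {x y : A} → P x → P y → P (if b then x else y)
if-intro P true  px _  = px
if-intro P false _  py = py

coprime-∣ʳ : ∀ {a b c} → Coprime a b → c ∣ b → Coprime a c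
coprime-∣ʳ a⊥b c∣b (i∣a , i∣c) = a⊥b (i∣a , ∣-trans i∣c c∣b)

%≡ᵇ0⇒∣ : ∀ m n .{{_ : NonZero n}} → (m % n ≡ᵇ 0) ≡ true → n ∣ m
%≡ᵇ0⇒∣ m n eq = m%n≡0⇒n∣m m n (≡ᵇ⇒≡ (m % n) 0 (subst T (sym eq) _))

%≢ᵇ0⇒∤ : ∀ m n .{{_ : NonZero n}} → (m % n ≡ᵇ 0) ≡ false → n ∤ m
%≢ᵇ0⇒∤ m n eq n∣m = subst T eq (≡⇒≡ᵇ (m % n) 0 (n∣m⇒m%n≡0 m n n∣m))

odd⇒coprime-2 : 2 ∤ t → Coprime t 2
odd⇒coprime-2 _ {zero} (_ , 0∣2) = contradiction (0∣⇒≡0 0∣2) λ ()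
odd⇒coprime-2 2∤t {suc i} (i∣t , i∣2) with ∣⇒≤ i∣2
... | s≤s z≤n = refl
... | s≤s (s≤s z≤n) = contradiction i∣t 2∤t

odd-∣-2* : 2 ∤ t → t ∣ 2 * m → t ∣ m
odd-∣-2* 2∤t = coprime-divisor (odd⇒coprime-2 2∤t)

odd-∣-4* : 2 ∤ t → t ∣ 4 * m → t ∣ m
odd-∣-4* {t} {m} 2∤t t∣4m = odd-∣-2* 2∤t (odd-∣-2* 2∤t (subst (t ∣_) (*-assoc 2 2 m) t∣4m))

odd-* : 2 ∤ x → 2 ∤ y → 2 ∤ x * y
odd-* {x} {y} 2∤x 2∤y 2∣xy = [ 2∤x , 2∤y ]′ (euclidsLemma x y prime[2] 2∣xy)

DoubleOrHalf : ℕ → ℕ → Set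
DoubleOrHalf x y = y ≡ 2 * x ⊎ 2 * y ≡ x

DoubleOrHalf-sym : DoubleOrHalf x y → DoubleOrHalf y x
DoubleOrHalf-sym = swap ∘′ Sum.map sym sym

odd-∣-DoubleOrHalf : 2 ∤ t → DoubleOrHalf x y → t ∣ x → t ∣ y
odd-∣-DoubleOrHalf _   (inj₁ refl) t∣x  = ∣n⇒∣m*n 2 t∣x
odd-∣-DoubleOrHalf 2∤t (inj₂ refl) t∣2y = odd-∣-2* 2∤t t∣2y

maxSqRoot : ℕ → ℕ
maxSqRoot m = suc (sqSearch m m)

sqSearch-∣ : ∀ m k → suc (sqSearch m k) * suc (sqSearch m k) ∣ m
sqSearch-∣ m zero = divides m (sym (*-identityʳ m))
sqSearch-∣ m (suc k) with suc k * suc k ∣? m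
... | yes k²∣m = k²∣m
... | no  _    = sqSearch-∣ m k

sqSearch-maximal : ∀ m k {e} → e ≤ k → e * e ∣ m → e ≤ suc (sqSearch m k)
sqSearch-maximal m zero    z≤n _ = z≤n
sqSearch-maximal m (suc k) e≤1+k e²∣m with suc k * suc k ∣? m
... | yes _ = e≤1+k
... | no k²∤m with m≤n⇒m<n∨m≡n e≤1+k
...   | inj₁ e<1+k = sqSearch-maximal m k (s≤s⁻¹ e<1+k) e²∣m
...   | inj₂ refl  = contradiction e²∣m k²∤m

maxSqRoot²∣ : ∀ m → maxSqRoot m * maxSqRoot m ∣ m
maxSqRoot²∣ m = sqSearch-∣ m m

≤maxSqRoot : ∀ m .{{_ : NonZero m}} {e} → e * e ∣ m → e ≤ maxSqRoot m
≤maxSqRoot m {zero}  _    = z≤n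
≤maxSqRoot m {suc e} e²∣m = sqSearch-maximal m m (≤-trans (m≤m*n (suc e) (suc e)) (∣⇒≤ e²∣m)) e²∣m

sqfree*maxSqRoot² : ∀ m → sqfree m * (maxSqRoot m * maxSqRoot m) ≡ m
sqfree*maxSqRoot² m = m/n*n≡m (maxSqRoot²∣ m)

sqfree-nonZero : ∀ m .{{_ : NonZero m}} → NonZero (sqfree m)
sqfree-nonZero m with sqfree m | sqfree*maxSqRoot² m
... | zero  | 0≡m = contradiction (sym 0≡m) (≢-nonZero⁻¹ m)
... | suc _ | _   = _

sqfree-unique : ∀ m .{{_ : NonZero m}} {s d} →
  s * (d * d) ≡ m → (∀ {e} → e * e ∣ m → e ≤ d) → sqfree m ≡ s
sqfree-unique m {s} {d} s*d²≡m maximal = *-cancelʳ-≡ (sqfree m) s (D * D) (begin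
  sqfree m * (D * D) ≡⟨ sqfree*maxSqRoot² m ⟩
  m                  ≡⟨ sym s*d²≡m ⟩
  s * (d * d)        ≡⟨ cong (λ r → s * (r * r)) (sym D≡d) ⟩
  s * (D * D)        ∎)
  where
  open ≡-Reasoning
  D : ℕ
  D = maxSqRoot m
  D≡d : D ≡ d
  D≡d = ≤-antisym (maximal (maxSqRoot²∣ m)) (≤maxSqRoot m (divides s (sym s*d²≡m)))

[q*2]²≡4*q² : ∀ q → (q * 2) * (q * 2) ≡ 4 * (q * q)
[q*2]²≡4*q² = solve-∀

sqfree-4* : ∀ k → sqfree (4 * k) ≡ sqfree k
sqfree-4* zero = refl
sqfree-4* k@(suc _) =
  sqfree-unique (4 * k) (trans (rearrange (sqfree k) D) (cong (4 *_) (sqfree*maxSqRoot² k))) maximal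
  where
  D : ℕ
  D = maxSqRoot k
  rearrange : ∀ s d → s * ((2 * d) * (2 * d)) ≡ 4 * (s * (d * d))
  rearrange = solve-∀
  maximal : ∀ {e} → e * e ∣ 4 * k → e ≤ 2 * D
  maximal {e} e²∣4k with 2 ∣? e
  ... | yes (divides q refl) = subst (_≤ 2 * D) (*-comm 2 q) (*-monoʳ-≤ 2 (≤maxSqRoot k {q} q²∣k))
    where
    q²∣k : q * q ∣ k
    q²∣k = *-cancelˡ-∣ 4 (subst (_∣ 4 * k) ([q*2]²≡4*q² q) e²∣4k)
  ... | no 2∤e = ≤-trans (≤maxSqRoot k (odd-∣-4* (odd-* 2∤e 2∤e) e²∣4k)) (m≤n*m D 2)

sqfree-2*-odd : 2 ∤ k → sqfree (2 * k) ≡ 2 * sqfree k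
sqfree-2*-odd {zero} 2∤0 = contradiction (2 ∣0) 2∤0
sqfree-2*-odd {k@(suc _)} 2∤k =
  sqfree-unique (2 * k) (trans (*-assoc 2 (sqfree k) (D * D)) (cong (2 *_) (sqfree*maxSqRoot² k))) maximal
  where
  D : ℕ
  D = maxSqRoot k
  maximal : ∀ {e} → e * e ∣ 2 * k → e ≤ D
  maximal {e} e²∣2k with 2 ∣? e
  ... | yes (divides q refl) = contradiction (*-cancelˡ-∣ 2 (∣-trans 4∣e² e²∣2k)) 2∤k
    where
    4∣e² : 4 ∣ (q * 2) * (q * 2)
    4∣e² = subst (4 ∣_) (sym ([q*2]²≡4*q² q)) (∣m⇒∣m*n (q * q) (∣-refl {4}))
  ... | no 2∤e = ≤maxSqRoot k (odd-∣-2* (odd-* 2∤e 2∤e) e²∣2k)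

-- Odd k is the base case; passing from j to 2j swaps the two alternatives, as sqfree (4j) = sqfree j.
sqfree-2* : ∀ k → DoubleOrHalf (sqfree k) (sqfree (2 * k))
sqfree-2* k = go k (<-wellFounded k)
  where
  even-step : ∀ j → DoubleOrHalf (sqfree j) (sqfree (2 * j)) →
              DoubleOrHalf (sqfree (j * 2)) (sqfree (2 * (j * 2)))
  even-step j = subst₂ DoubleOrHalf (cong sqfree (*-comm 2 j))
    (trans (sym (sqfree-4* j)) (cong sqfree (4*j≡2*[j*2] j))) ∘′ DoubleOrHalf-sym
    where
    4*j≡2*[j*2] : ∀ j → 4 * j ≡ 2 * (j * 2)
    4*j≡2*[j*2] = solve-∀
  go : ∀ k → Acc ℕ._<_ k → DoubleOrHalf (sqfree k) (sqfree (2 * k))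
  go k _ with 2 ∣? k
  ... | no 2∤k = inj₁ (sqfree-2*-odd 2∤k)
  go .(0 * 2) _ | yes (divides zero refl) = inj₁ refl
  go .(j * 2) (acc rec) | yes (divides j@(suc _) refl) = even-step j (go j (rec (m<m*n j 2 (s≤s (s≤s z≤n)))))

sqfree-DoubleOrHalf : DoubleOrHalf x y → DoubleOrHalf (sqfree x) (sqfree y)
sqfree-DoubleOrHalf {x} (inj₁ refl) = sqfree-2* x
sqfree-DoubleOrHalf {y = y} (inj₂ refl) = DoubleOrHalf-sym (sqfree-2* y)

oddGo-∣ : ∀ fuel m → oddGo fuel m ∣ m
oddGo-∣ zero       m       = ∣-refl
oddGo-∣ (suc fuel) zero    = ∣-refl
oddGo-∣ (suc fuel) (suc m) with suc m % 2 ≡ᵇ 0 in eq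
... | true  = ∣-trans (oddGo-∣ fuel (suc m / 2)) (m/n∣m (%≡ᵇ0⇒∣ (suc m) 2 eq))
... | false = ∣-refl

oddPart-∣ : ∀ m → oddPart m ∣ m
oddPart-∣ m = oddGo-∣ m m

oddGo-odd : ∀ fuel m .{{_ : NonZero m}} → m ≤ fuel → 2 ∤ oddGo fuel m
oddGo-odd (suc fuel) (suc m) m≤fuel with suc m % 2 ≡ᵇ 0 in eq
... | false = %≢ᵇ0⇒∤ (suc m) 2 eq
... | true  = oddGo-odd fuel (suc m / 2) {{ℕ.>-nonZero m/2>0}}
                (s≤s⁻¹ (≤-trans (m/n<m (suc m) 2 (s≤s (s≤s z≤n))) m≤fuel))
  where
  m/2>0 : suc m / 2 ℕ.> 0
  m/2>0 = m≥n⇒m/n>0 (∣⇒≤ (%≡ᵇ0⇒∣ (suc m) 2 eq))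

oddPart-odd : ∀ m .{{_ : NonZero m}} → 2 ∤ oddPart m
oddPart-odd m = oddGo-odd m m ≤-refl

numDen : ℚ → ℕ
numDen q = ∣ ↥ q ℤ.* ↧ q ∣

numDen-nonZero : ∀ {q} → 0ℚ < q → NonZero (numDen q)
numDen-nonZero {mkℚ (+ suc _) _ _} _ = _
numDen-nonZero {mkℚ (+ zero)  _ _} (*<* (ℤ.+<+ ()))
numDen-nonZero {mkℚ -[1+ _ ]  _ _} (*<* ())

numDen-neg : ∀ q → numDen (- q) ≡ numDen q
numDen-neg q = begin
  ∣ ↥ (- q) ℤ.* ↧ (- q) ∣ ≡⟨ cong₂ (λ i j → ∣ i ℤ.* j ∣) (↥-neg q) (↧-neg q) ⟩
  ∣ ℤ.- ↥ q ℤ.* ↧ q ∣     ≡⟨ cong ∣_∣ (sym (neg-distribˡ-* (↥ q) (↧ q))) ⟩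
  ∣ ℤ.- (↥ q ℤ.* ↧ q) ∣   ≡⟨ ∣-i∣≡∣i∣ (↥ q ℤ.* ↧ q) ⟩
  numDen q                ∎
  where open ≡-Reasoning

-- A/B is 2a/b reduced by g = gcd (2a, b), which divides 2 when a and b are coprime.
DoubleOrHalf-reduce : ∀ {a b A B g} → g ∣ 2 → A * g ≡ 2 * a → B * g ≡ b → DoubleOrHalf (a * b) (A * B)
DoubleOrHalf-reduce {g = zero} 0∣2 _ _ = contradiction (0∣⇒≡0 0∣2) λ ()
DoubleOrHalf-reduce {a} {b} {A} {B} {g = 1} _ A≡2a B≡b = inj₁ (begin
  A * B       ≡⟨ cong₂ _*_ (trans (sym (*-identityʳ A)) A≡2a) (trans (sym (*-identityʳ B)) B≡b) ⟩
  2 * a * b   ≡⟨ *-assoc 2 a b ⟩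
  2 * (a * b) ∎)
  where open ≡-Reasoning
DoubleOrHalf-reduce {a} {b} {A} {B} {g = 2} _ A*2≡2a B*2≡b = inj₂ (begin
  2 * (A * B) ≡⟨ rearrange A B ⟩
  A * (B * 2) ≡⟨ cong₂ _*_ (*-cancelʳ-≡ A a 2 (trans A*2≡2a (*-comm 2 a))) B*2≡b ⟩
  a * b       ∎)
  where
  open ≡-Reasoning
  rearrange : ∀ x y → 2 * (x * y) ≡ x * (y * 2)
  rearrange = solve-∀
DoubleOrHalf-reduce {g = suc (suc (suc _))} g∣2 _ _ = contradiction (∣⇒≤ g∣2) λ { (s≤s (s≤s ())) }

numDen-2* : ∀ q → DoubleOrHalf (numDen q) (numDen ((+ 2 ℚ./ 1) ℚ.* q))
numDen-2* q@(mkℚ n d-1 n⊥d) = subst₂ DoubleOrHalf (sym (abs-* n (↧ q))) (sym (abs-* (↥ 2q) (↧ 2q)))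
  (DoubleOrHalf-reduce {∣ n ∣} {d} {∣ ↥ 2q ∣} {↧ₙ 2q} g∣2 A*g≡2a B*g≡b)
  where
  d g : ℕ
  d = suc d-1
  2q : ℚ
  2q = (+ 2 ℚ./ 1) ℚ.* q
  i : ℤ
  i = + 2 ℤ.* n
  g = gcd ∣ i ∣ (1 * d)
  ∣i∣≡2a : ∣ i ∣ ≡ 2 * ∣ n ∣
  ∣i∣≡2a = abs-* (+ 2) n
  A*g≡2a : ∣ ↥ 2q ∣ * g ≡ 2 * ∣ n ∣
  A*g≡2a = trans (sym (abs-* (↥ 2q) (+ g))) (trans (cong ∣_∣ (↥-/ i (1 * d))) ∣i∣≡2a)
  B*g≡b : ↧ₙ 2q * g ≡ d
  B*g≡b = trans (sym (abs-* (↧ 2q) (+ g))) (trans (cong ∣_∣ (↧-/ i (1 * d))) (*-identityˡ d))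
  g∣2 : g ∣ 2
  g∣2 = coprime-factors (recompute n⊥d)
    ( subst (g ∣_) (trans ∣i∣≡2a (*-comm 2 ∣ n ∣)) (gcd[m,n]∣m ∣ i ∣ (1 * d))
    , ∣m⇒∣m*n 2 (subst (g ∣_) (*-identityˡ d) (gcd[m,n]∣n ∣ i ∣ (1 * d))))

∣disc∣≡sqfree⊎4*sqfree : ∀ q → ∣ disc q ∣ ≡ sqfree (numDen q) ⊎ ∣ disc q ∣ ≡ 4 * sqfree (numDen q)
∣disc∣≡sqfree⊎4*sqfree q = if-intro (λ D → ∣ D ∣ ≡ s ⊎ ∣ D ∣ ≡ 4 * s) ((σ ℤ.◃ s) ℤ.%ℕ 4 ≡ᵇ 1)
  (inj₁ (abs-◃ σ s))
  (inj₂ (trans (abs-* (+ 4) (σ ℤ.◃ s)) (cong (4 *_) (abs-◃ σ s))))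
  where
  s : ℕ
  s = sqfree (numDen q)
  σ : Sign
  σ = ℤ.sign (↥ q ℤ.* ↧ q)

sqfree∣∣disc∣ : ∀ q → sqfree (numDen q) ∣ ∣ disc q ∣
sqfree∣∣disc∣ q with ∣disc∣≡sqfree⊎4*sqfree q
... | inj₁ ∣D∣≡s  = ∣-reflexive (sym ∣D∣≡s)
... | inj₂ ∣D∣≡4s = subst (sqfree (numDen q) ∣_) (sym ∣D∣≡4s) (∣n⇒∣m*n 4 ∣-refl)

∣disc∣∣4*sqfree : ∀ q → ∣ disc q ∣ ∣ 4 * sqfree (numDen q)
∣disc∣∣4*sqfree q with ∣disc∣≡sqfree⊎4*sqfree q
... | inj₁ ∣D∣≡s  = subst (_∣ 4 * sqfree (numDen q)) (sym ∣D∣≡s) (∣n⇒∣m*n 4 ∣-refl)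
... | inj₂ ∣D∣≡4s = ∣-reflexive ∣D∣≡4s

∣disc∣-nonZero : ∀ q .{{_ : NonZero (numDen q)}} → NonZero ∣ disc q ∣
∣disc∣-nonZero q with ∣disc∣≡sqfree⊎4*sqfree q
... | inj₁ ∣D∣≡s  = subst NonZero (sym ∣D∣≡s) (sqfree-nonZero (numDen q))
... | inj₂ ∣D∣≡4s = subst NonZero (sym ∣D∣≡4s) (m*n≢0 4 _ {{_}} {{sqfree-nonZero (numDen q)}})

oddPart∣disc∣-odd : ∀ q .{{_ : NonZero (numDen q)}} → 2 ∤ oddPart ∣ disc q ∣
oddPart∣disc∣-odd q = oddPart-odd ∣ disc q ∣ {{∣disc∣-nonZero q}}

oddPart∣disc∣∣sqfree : ∀ q .{{_ : NonZero (numDen q)}} → oddPart ∣ disc q ∣ ∣ sqfree (numDen q)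
oddPart∣disc∣∣sqfree q = odd-∣-4* (oddPart∣disc∣-odd q) (∣-trans (oddPart-∣ ∣ disc q ∣) (∣disc∣∣4*sqfree q))

oddPart∣disc∣∣∣disc-neg∣ : ∀ q .{{_ : NonZero (numDen q)}} → oddPart ∣ disc q ∣ ∣ ∣ disc (- q) ∣
oddPart∣disc∣∣∣disc-neg∣ q = ∣-trans
  (subst (λ m → oddPart ∣ disc q ∣ ∣ sqfree m) (sym (numDen-neg q)) (oddPart∣disc∣∣sqfree q))
  (sqfree∣∣disc∣ (- q))

oddPart∣disc∣∣∣disc-2*∣ : ∀ q .{{_ : NonZero (numDen q)}} → oddPart ∣ disc q ∣ ∣ ∣ disc ((+ 2 ℚ./ 1) ℚ.* q) ∣
oddPart∣disc∣∣∣disc-2*∣ q = ∣-trans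
  (odd-∣-DoubleOrHalf (oddPart∣disc∣-odd q) (sqfree-DoubleOrHalf (numDen-2* q)) (oddPart∣disc∣∣sqfree q))
  (sqfree∣∣disc∣ ((+ 2 ℚ./ 1) ℚ.* q))

%ℕ≡0⇒∣∣∣ : ∀ c d .{{_ : NonZero d}} → c ℤ.%ℕ d ≡ 0 → d ∣ ∣ c ∣
%ℕ≡0⇒∣∣∣ c d c%d≡0 = divides ∣ c ℤ./ℕ d ∣ (trans (cong ∣_∣ c≡[c/d]*d) (abs-* (c ℤ./ℕ d) (+ d)))
  where
  c≡[c/d]*d : c ≡ (c ℤ./ℕ d) ℤ.* + d
  c≡[c/d]*d = trans (a≡a%ℕn+[a/ℕn]*n c d)
    (trans (cong (λ r → + r ℤ.+ (c ℤ./ℕ d) ℤ.* + d) c%d≡0) (ℤ.+-identityˡ _))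

zero-or-unit≡0 : ∀ b b′ → (if b then + 0 else (if b′ then + 1 else ℤ.- + 1)) ≡ + 0 → T b
zero-or-unit≡0 true  _     _  = _
zero-or-unit≡0 false true  ()
zero-or-unit≡0 false false ()

kronPrime≡0⇒∣ : ∀ c k → kronPrime c k ≡ + 0 → 2 + k ∣ ∣ c ∣
kronPrime≡0⇒∣ c k χ≡0 = %ℕ≡0⇒∣∣∣ c (2 + k) (≡ᵇ⇒≡ _ 0 (residue≡0 k χ≡0))
  where
  residue≡0 : ∀ k → kronPrime c k ≡ + 0 → T (c ℤ.%ℕ (2 + k) ≡ᵇ 0)
  residue≡0 zero    = zero-or-unit≡0 (c ℤ.%ℕ 2 ≡ᵇ 0) _
  residue≡0 (suc k) = zero-or-unit≡0 (c ℤ.%ℕ (3 + k) ≡ᵇ 0) _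

kronPrime-1 : ∀ k → kronPrime (+ 1) k ≡ + 1
kronPrime-1 zero    = refl
kronPrime-1 (suc k) = refl

ν-∤ : ∀ k m → 2 + k ∤ m → ν[2+ k ] m ≡ 0
ν-∤ k zero    _ = refl
ν-∤ k (suc m) p∤m with suc m % (2 + k) ≡ᵇ 0 in eq
... | true  = contradiction (%≡ᵇ0⇒∣ (suc m) (2 + k) eq) p∤m
... | false = refl

^≢0 : ∀ i n → i ≢ + 0 → i ℤ.^ n ≢ + 0
^≢0 i zero    _   ()
^≢0 i (suc n) i≢0 iⁿ⁺¹≡0 = [ i≢0 , ^≢0 i n i≢0 ]′ (i*j≡0⇒i≡0∨j≡0 i iⁿ⁺¹≡0)

foldr-*-≢0 : ∀ (F : ℕ → ℤ) xs → (∀ k → F k ≢ + 0) → foldr ℤ._*_ (+ 1) (map F xs) ≢ + 0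
foldr-*-≢0 F []       _    ()
foldr-*-≢0 F (x ∷ xs) F≢0 ∏≡0 = [ F≢0 x , foldr-*-≢0 F xs F≢0 ]′ (i*j≡0⇒i≡0∨j≡0 (F x) ∏≡0)

foldr-*-≡1 : ∀ (F : ℕ → ℤ) xs → (∀ k → F k ≡ + 1) → foldr ℤ._*_ (+ 1) (map F xs) ≡ + 1
foldr-*-≡1 F []       _    = refl
foldr-*-≡1 F (x ∷ xs) F≡1 = cong₂ ℤ._*_ (F≡1 x) (foldr-*-≡1 F xs F≡1)

kronecker-1 : ∀ a → kronecker (+ 1) a ≡ + 1
kronecker-1 zero        = refl
kronecker-1 a@(suc _) = foldr-*-≡1 _ (upTo a) λ k →
  trans (if-cong-then ⌊ prime? (2 + k) ⌋ (power≡1 k)) (if-eta ⌊ prime? (2 + k) ⌋)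
  where
  power≡1 : ∀ k → kronPrime (+ 1) k ℤ.^ ν[2+ k ] a ≡ + 1
  power≡1 k = trans (cong (ℤ._^ ν[2+ k ] a) (kronPrime-1 k)) (^-zeroˡ (ν[2+ k ] a))

kronecker≢0 : ∀ c a → Coprime a ∣ c ∣ → kronecker c a ≢ + 0
kronecker≢0 c zero a⊥c rewrite 0-coprimeTo-m⇒m≡1 a⊥c = λ ()
kronecker≢0 c a@(suc _) a⊥c = foldr-*-≢0 _ (upTo a) λ k →
  if-intro (_≢ + 0) ⌊ prime? (2 + k) ⌋ (power≢0 k) λ ()
  where
  power≢0 : ∀ k → kronPrime c k ℤ.^ ν[2+ k ] a ≢ + 0
  power≢0 k with kronPrime c k ℤ.≟ + 0
  ... | no  χ≢0 = ^≢0 _ (ν[2+ k ] a) χ≢0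
  ... | yes χ≡0 rewrite ν-∤ k a (λ p∣a → contradiction (a⊥c (p∣a , kronPrime≡0⇒∣ c k χ≡0)) λ ()) = λ ()

∣εsign∣ : ∀ b → ∣ εsign b ∣ ≡ 1
∣εsign∣ b = trans (if-float ∣_∣ (b ℤ.%ℕ 4 ≡ᵇ 1)) (if-eta (b ℤ.%ℕ 4 ≡ᵇ 1))

∣εsign*+∣ : ∀ b c → ∣ εsign b ℤ.* + c ∣ ≡ c
∣εsign*+∣ b c = trans (abs-* (εsign b) (+ c)) (trans (cong (_* c) (∣εsign∣ b)) (*-identityˡ c))

module _ (f n : ℕ) where

  ∣γ∣∣f : ∀ D → ∣ γ f n D ∣ ∣ f
  ∣γ∣∣f D = if-intro (λ x → ∣ x ∣ ∣ f) (ν₂ f <ᵇ ν₂ ∣ D ∣)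
    (∣-trans (∣-reflexive (∣εsign*+∣ (+ fₒ⊓D) fₒ⊓D)) (∣-trans (gcd[m,n]∣m (oddPart f) ∣ D ∣) (oddPart-∣ f)))
    (∣-trans (∣-reflexive (∣εsign*+∣ (divExact D f⊓D) f⊓D)) (gcd[m,n]∣m f ∣ D ∣))
    where
    f⊓D fₒ⊓D : ℕ
    f⊓D = gcd f ∣ D ∣
    fₒ⊓D = gcd (oddPart f) ∣ D ∣

  γ-guarded : Bool → ℤ → ℤ
  γ-guarded b D = if b ∧ ⌊ ∣ D ∣ ∣? lcm f n ⌋ then γ f n D else + 1

  -- γ₀ f n D and γ₁ f n D are definitionally γ-guarded b D, with b = not (∣D∣ ∣ n) resp. ν₂ n < ν₂ f.
  data GuardedValue (t : ℕ) : ℤ → Set where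
    trivial : GuardedValue t (+ 1)
    guarded : ∀ b D → t ∣ ∣ D ∣ → GuardedValue t (γ-guarded b D)

  GuardedValue⇒∣f : ∀ {t x} → GuardedValue t x → ∣ x ∣ ∣ f
  GuardedValue⇒∣f trivial         = 1∣ f
  GuardedValue⇒∣f (guarded b D _) = if-intro (λ x → ∣ x ∣ ∣ f) (b ∧ ⌊ ∣ D ∣ ∣? lcm f n ⌋) (∣γ∣∣f D) (1∣ f)

  GuardedValue⇒≡1 : ∀ {t x} → t ∤ lcm f n → GuardedValue t x → x ≡ + 1
  GuardedValue⇒≡1 _ trivial = refl
  GuardedValue⇒≡1 t∤[f,n] (guarded b D t∣D) with ∣ D ∣ ∣? lcm f n
  ... | yes D∣[f,n] = contradiction (∣-trans t∣D D∣[f,n]) t∤[f,n]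
  ... | no  _       = if-cong (∧-zeroʳ b)

γg-guarded : ∀ g g₀ h f n → 0ℚ < g₀ → GuardedValue f n (oddPart ∣ disc g₀ ∣) (γg g g₀ h f n)
γg-guarded g g₀ h f n 0<g₀ =
  if-intro P g>0
    (if-intro P ν₂n≤ν₂h trivial (γ₀-guarded (disc g₀) (oddPart-∣ _)))
    (if-intro P ν₂h+2≤ν₂n (γ₀-guarded (disc g₀) (oddPart-∣ _))
    (if-intro P ν₂n≡1∧ν₂h≡0 (γ₀-guarded (disc (- g₀)) (oddPart∣disc∣∣∣disc-neg∣ g₀))
    (if-intro P ν₂h≡1∧ν₂n≡2∧8∣D (γ₀-guarded (disc ((+ 2 ℚ./ 1) ℚ.* g₀)) (oddPart∣disc∣∣∣disc-2*∣ g₀))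
    (if-intro P ν₂n≤ν₂h trivial (guarded (ν₂ n <ᵇ ν₂ f) (disc g₀) (oddPart-∣ _))))))
  where
  instance
    _ : NonZero (numDen g₀)
    _ = numDen-nonZero 0<g₀
  g>0 ν₂n≤ν₂h ν₂h+2≤ν₂n ν₂n≡1∧ν₂h≡0 ν₂h≡1∧ν₂n≡2∧8∣D : Bool
  g>0 = ⌊ 0ℚ <? g ⌋
  ν₂n≤ν₂h = ν₂ n ≤ᵇ ν₂ h
  ν₂h+2≤ν₂n = 2 + ν₂ h ≤ᵇ ν₂ n
  ν₂n≡1∧ν₂h≡0 = (ν₂ n ≡ᵇ 1) ∧ (ν₂ h ≡ᵇ 0)
  ν₂h≡1∧ν₂n≡2∧8∣D = (ν₂ h ≡ᵇ 1) ∧ (ν₂ n ≡ᵇ 2) ∧ ⌊ 8 ∣? ∣ disc g₀ ∣ ⌋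
  P : ℤ → Set
  P = GuardedValue f n (oddPart ∣ disc g₀ ∣)
  γ₀-guarded : ∀ D → oddPart ∣ disc g₀ ∣ ∣ ∣ D ∣ → P (γ₀ f n D)
  γ₀-guarded D = guarded (not ⌊ ∣ D ∣ ∣? n ⌋) D

proposition3 : (g g₀ : ℚ) (h n a f : ℕ) →
    g ≢ 0ℚ → g ≢ 1ℚ → g ≢ - 1ℚ →
    0ℚ < g₀ → ¬ IsPerfectPower g₀ → 1 ≤ h →
    (g ≡ g₀ ^ℚ h ⊎ g ≡ - (g₀ ^ℚ h)) →
    1 ≤ n → 1 ≤ a → 1 ≤ f → Coprime a f → gcd f n ∣ (a ∸ 1) →
    (kronecker (γg g g₀ h f n) a ≢ + 0)
    × (¬ (oddPart ∣ disc g₀ ∣ ∣ lcm f n) → kronecker (γg g g₀ h f n) a ≡ + 1)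
proposition3 g g₀ h n a f _ _ _ 0<g₀ _ _ _ _ _ _ a⊥f _ =
    kronecker≢0 (γg g g₀ h f n) a (coprime-∣ʳ a⊥f (GuardedValue⇒∣f f n γg-form))
  , λ δ∤[f,n] → trans (cong (λ c → kronecker c a) (GuardedValue⇒≡1 f n δ∤[f,n] γg-form)) (kronecker-1 a)
  where
  γg-form : GuardedValue f n (oddPart ∣ disc g₀ ∣) (γg g g₀ h f n)
  γg-form = γg-guarded g g₀ h f n 0<g₀
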